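{- Let $\mathfrak{S}=(S,R)$ be a relational signature and let $T$ be an RHL theory over $\mathfrak{S}$. Then there exist an algebraic signature $\mathfrak{S}'=(S,P\sqcup F)$ on the same set of sorts with $P=R$ (with the same arities) and an epic PHL theory $T'$ over $\mathfrak{S}'$ such that the forgetful functor $\mathrm{Alg}(\mathfrak{S}')\to\mathrm{Rel}(\mathfrak{S})$ (forgetting the relations $f_X$ for $f\in F$) restricts to an equivalence of categories between $\mathrm{Mod}(T')$ and the full subcategory $\{[\mathcal S]\mid\mathcal S\in T\}^\perp$ of relational $\mathfrak S$-structures orthogonal to all classifying morphisms of sequents of $T$. In particular, if $T$ is strong, then $\mathrm{Mod}(T')\simeq\mathrm{Mod}(T)$.
   Context: Relational signatures and structures: a relational signature $(S,R)$ has sorts $S$, relation symbols $R$ with arities $r:s_1\times\dots\times s_n$; a relational structure $X$ has carriers $X_s$ and relations $r_X\subseteq X_{s_1}\times\dots\times X_{s_n}$; morphisms are sortwise functions preserving relations; category $\mathrm{Rel}$. RHL: variables carry sorts; atoms are $r(v_1,\dots,v_n)$, $v\downarrow$, $u\equiv v$; formulas are finite conjunctions of atoms; sequents $\mathcal F\implies\mathcal G$; theories are sets of sequents. An interpretation of $\mathcal F$ in $X$ is a sort-respecting assignment of elements to the variables of $\mathcal F$ making all relation and equality atoms true; $X$ satisfies $\mathcal F\implies\mathcal G$ if every interpretation of $\mathcal F$ extends to one of $\mathcal F\land\mathcal G$; $\mathrm{Mod}(T)$ is the full subcategory of structures satisfying all sequents of $T$. The classifying structure $[\mathcal F]$ has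 as elements the variables of $\mathcal F$ modulo the equivalence generated by its equality atoms, with $r_{[\mathcal F]}$ the tuples of classes $([v_1],\dots,[v_n])$ of atoms $r(v_1,\dots,v_n)$ of $\mathcal F$; the classifying morphism $[\mathcal S]:[\mathcal F]\to[\mathcal F\land\mathcal G]$ sends $[v]$ to $[v]$. $X$ is orthogonal to $f:A\to B$ if every $a:A\to X$ factors uniquely as $bf$, injective if such $b$ exists; for a class $M$, $M^\perp$, $M^\pitchfork$ are the full subcategories of orthogonal/injective objects; $M$ is strong if $M^\pitchfork=M^\perp$, and $T$ is strong if $\{[\mathcal S]\mid\mathcal S\in T\}$ is. An algebraic signature is a relational signature $(S,R)$ with a partition $R=P\sqcup F$ into predicate symbols and function symbols, each function symbol having non-empty arity; one writes $f:s_1\times\dots\times s_n\to s$ if $f$ has relational arity $s_1\times\dots\times s_n\times s$. An algebraic structure is a relational structure in which each $f_X$ is the graph of a partial function $f_X:X_{s_1}\times\dots\times X_{s_n}\rightharpoonup X_s$; $\mathrm{Alg}(\mathfrak S')$ is the full subcategory of $\mathrm{Rel}(\mathfrak S')$ of algebraic structures. PHL terms: variables, and $f(t_1,\dots,t_n)$ for $f\in F$ and terms of matching sorts. PHL atoms: $p(t_1,\dots,t_n)$ with $p\in P$, $t\downarrow$, $t_1\equiv t_2$ (same sort); PHL formulas, sequents and theories as in RHL. An interpretation of a PHL formula in an algebraic structure $X$ is an assignment $I$ of the variables such that every term occurring is defined under the recursive evaluation $I(f(t_1,\dots,t_n))=f_X(I(t_1),\dots,I(t_n))$, and predicate and equality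 atoms hold; satisfaction and $\mathrm{Mod}(T')\subseteq\mathrm{Alg}(\mathfrak S')$ as in RHL. A PHL sequent is epic if every variable in its conclusion also occurs in its premise; a theory is epic if all its sequents are. RHL sequents over $\mathfrak S$ are regarded as PHL sequents over $\mathfrak S'$ via $P=R$. -}

module Defs where

open import Level using (0ℓ)
open import Function using (_on_)
open import Data.Nat using (ℕ; suc)
open import Data.Fin using (Fin; zero; suc)
open import Data.Product using (Σ; Σ-syntax; _×_; _,_; proj₁; proj₂)
open import Data.Sum using (_⊎_; inj₁; inj₂)
open import Data.List using (List; _++_)
open import Data.List.Relation.Unary.Any using (Any)
open import Data.List.Relation.Unary.Any.Properties using (++⁺ˡ)
open import Data.List.Relation.Unary.All using (All)
open import Data.List.Membership.Propositional using (_∈_)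
open import Relation.Binary using (Setoid; Rel)
import Relation.Binary.Construct.Closure.Equivalence as EqC
import Relation.Binary.Construct.On as On

record RelSig : Set₁ where
  field
    Sort : Set
    Sym  : Set
    len  : Sym → ℕ
    srt  : (r : Sym) → Fin (len r) → Sort

-- Relational structures.  Carriers are setoids (the constructive
-- rendering of sets); relations are required to respect the setoid
-- equality.

module _ (𝔖 : RelSig) where
  open RelSig 𝔖

  record Str : Set₁ where
    field
      car     : Sort → Setoid 0ℓ 0ℓ
      rel     : (r : Sym) → ((i : Fin (len r)) → Setoid.Carrier (car (srt r i))) → Set
      rel-resp : (r : Sym) {xs ys : (i : Fin (len r)) → Setoid.Carrier (car (srt r i))} →
                 (∀ i → Setoid._≈_ (car (srt r i)) (xs i) (ys i)) → rel r xs → rel r ys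

module _ {𝔖 : RelSig} where
  open RelSig 𝔖
  open Str

  El : Str 𝔖 → Sort → Set
  El X s = Setoid.Carrier (car X s)

  Eq : (X : Str 𝔖) (s : Sort) → El X s → El X s → Set
  Eq X s = Setoid._≈_ (car X s)

  record Hom (X Y : Str 𝔖) : Set where
    field
      fun  : (s : Sort) → El X s → El Y s
      cong : (s : Sort) {x y : El X s} → Eq X s x y → Eq Y s (fun s x) (fun s y)
      pres : (r : Sym) (xs : (i : Fin (len r)) → El X (srt r i)) →
             rel X r xs → rel Y r (λ i → fun (srt r i) (xs i))
  open Hom

  _≈ₕ_ : {X Y : Str 𝔖} → Hom X Y → Hom X Y → Set
  _≈ₕ_ {Y = Y} h k = ∀ s x → Eq Y s (fun h s x) (fun k s x)

  idₕ : {X : Str 𝔖} → Hom X X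
  idₕ = record { fun = λ s x → x ; cong = λ s e → e ; pres = λ r xs p → p }

  _∘ₕ_ : {X Y Z : Str 𝔖} → Hom Y Z → Hom X Y → Hom X Z
  g ∘ₕ f = record
    { fun  = λ s x → fun g s (fun f s x)
    ; cong = λ s e → cong g s (cong f s e)
    ; pres = λ r xs p → pres g r _ (pres f r xs p) }

  Iso : Str 𝔖 → Str 𝔖 → Set
  Iso X Y = Σ[ u ∈ Hom X Y ] Σ[ v ∈ Hom Y X ] ((v ∘ₕ u) ≈ₕ idₕ × (u ∘ₕ v) ≈ₕ idₕ)

  Orthogonal : (X : Str 𝔖) {A B : Str 𝔖} → Hom A B → Set
  Orthogonal X f = (a : Hom _ X) →
    Σ[ b ∈ Hom _ X ] ((b ∘ₕ f) ≈ₕ a × ((b' : Hom _ X) → (b' ∘ₕ f) ≈ₕ a → b' ≈ₕ b))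

  Injective : (X : Str 𝔖) {A B : Str 𝔖} → Hom A B → Set
  Injective X f = (a : Hom _ X) → Σ[ b ∈ Hom _ X ] ((b ∘ₕ f) ≈ₕ a)

  -- assignments of elements of X to the variables satisfying an
  -- occurrence predicate; variables are pairs (sort , index).
  -- Values do not depend on the chosen occurrence proof (up to ≈).
  record Assign (X : Str 𝔖) (Occ : Sort → ℕ → Set) : Set where
    field
      val : {s : Sort} {n : ℕ} → Occ s n → El X s
      irr : {s : Sort} {n : ℕ} (p q : Occ s n) → Eq X s (val p) (val q)
  open Assign public

  Value : {X : Str 𝔖} {Occ : Sort → ℕ → Set} → Assign X Occ → (s : Sort) → ℕ → El X s → Set
  Value {X} {Occ} I s n x = Σ[ p ∈ Occ s n ] Eq X s (val I p) x

  Extends : {X : Str 𝔖} {O₁ O₂ : Sort → ℕ → Set} →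
            (inc : ∀ {s n} → O₁ s n → O₂ s n) → Assign X O₂ → Assign X O₁ → Set
  Extends {X} inc J I = ∀ {s n} (p : _) → Eq X s (val J (inc {s} {n} p)) (val I p)

module RHL (𝔖 : RelSig) where
  open RelSig 𝔖
  open Str

  data Atom : Set where
    relA : (r : Sym) → (Fin (len r) → ℕ) → Atom
    def : Sort → ℕ → Atom
    eqv : Sort → ℕ → ℕ → Atom

  Formula : Set
  Formula = List Atom

  record Sequent : Set where
    constructor _⟹_
    field
      prem  : Formula
      concl : Formula
  open Sequent public

  Theory : Set₁
  Theory = Sequent → Set

  data OccA : Atom → Sort → ℕ → Set where
    rel-occ : ∀ r vs i → OccA (relA r vs) (srt r i) (vs i)
    def-occ : ∀ s n → OccA (def s n) s n
    eq-occˡ : ∀ s n m → OccA (eqv s n m) s n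
    eq-occʳ : ∀ s n m → OccA (eqv s n m) s m

  Occ : Formula → Sort → ℕ → Set
  Occ F s n = Any (λ a → OccA a s n) F

  module _ (X : Str 𝔖) where
    HoldsA : {F : Formula} → Assign X (Occ F) → Atom → Set
    HoldsA I (relA r vs) = Σ[ xs ∈ ((i : Fin (len r)) → El X (srt r i)) ]
                            ((∀ i → Value I (srt r i) (vs i) (xs i)) × rel X r xs)
    HoldsA I (def s n) = Σ[ x ∈ El X s ] Value I s n x
    HoldsA I (eqv s n m) = Σ[ x ∈ El X s ] Σ[ y ∈ El X s ]
                             (Value I s n x × Value I s m y × Eq X s x y)

    Interp : Formula → Set
    Interp F = Σ[ I ∈ Assign X (Occ F) ] All (HoldsA I) F

    Sat : Sequent → Set
    Sat (F ⟹ G) = (I : Interp F) →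
      Σ[ J ∈ Interp (F ++ G) ] Extends (++⁺ˡ {ys = G}) (proj₁ J) (proj₁ I)

  Mod : Theory → Str 𝔖 → Set
  Mod T X = (S : Sequent) → T S → Sat X S

  Step : Formula → Sort → Rel ℕ 0ℓ
  Step F s n m = eqv s n m ∈ F

  Cls : Formula → Sort → Rel ℕ 0ℓ
  Cls F s = EqC.EqClosure (Step F s)

  ⟦_⟧ : Formula → Str 𝔖
  ⟦ F ⟧ = record
    { car = λ s → record
        { Carrier = Σ ℕ (Occ F s)
        ; _≈_ = Cls F s on proj₁
        ; isEquivalence = On.isEquivalence proj₁ (EqC.isEquivalence (Step F s)) }
    ; rel = λ r xs → Σ[ vs ∈ (Fin (len r) → ℕ) ]
              (relA r vs ∈ F × (∀ i → Cls F (srt r i) (proj₁ (xs i)) (vs i)))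
    ; rel-resp = λ r e (vs , m , c) → vs , m , λ i →
        EqC.transitive (Step F (srt r i)) (EqC.symmetric (Step F (srt r i)) (e i)) (c i) }

  ⟦_⟧ₛ : (S : Sequent) → Hom ⟦ prem S ⟧ ⟦ prem S ++ concl S ⟧
  ⟦ F ⟹ G ⟧ₛ = record
    { fun = λ s x → proj₁ x , ++⁺ˡ (proj₂ x)
    ; cong = λ s → EqC.map ++⁺ˡ
    ; pres = λ r xs (vs , m , c) → vs , ++⁺ˡ m , λ i → EqC.map ++⁺ˡ (c i) }

  Orth : Theory → Str 𝔖 → Set
  Orth T X = (S : Sequent) → T S → Orthogonal X ⟦ S ⟧ₛ

  Inj : Theory → Str 𝔖 → Set
  Inj T X = (S : Sequent) → T S → Injective X ⟦ S ⟧ₛ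

  Strong : Theory → Set₁
  Strong T = (X : Str 𝔖) → (Inj T X → Orth T X) × (Orth T X → Inj T X)

record FunSyms (𝔖 : RelSig) : Set₁ where
  open RelSig 𝔖
  field
    Fun : Set
    ar  : Fun → ℕ
    dom : (f : Fun) → Fin (ar f) → Sort
    cod : Fun → Sort

-- the underlying relational signature 𝔖' (relation symbols R ⊎ F).
-- CONVENTION: the relational arity of f lists the output sort first,
-- then the input sorts (a harmless reordering of s₁×…×sₙ×s).
AlgSig : (𝔖 : RelSig) → FunSyms 𝔖 → RelSig
AlgSig 𝔖 Φ = record
  { Sort = Sort ; Sym = Sym ⊎ Fun ; len = len' ; srt = srt' }
  where
  open RelSig 𝔖
  open FunSyms Φ
  len' : Sym ⊎ Fun → ℕ
  len' (inj₁ r) = len r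
  len' (inj₂ f) = suc (ar f)
  srt' : (r : Sym ⊎ Fun) → Fin (len' r) → Sort
  srt' (inj₁ r) i = srt r i
  srt' (inj₂ f) zero = cod f
  srt' (inj₂ f) (suc i) = dom f i

module PHL (𝔖 : RelSig) (Φ : FunSyms 𝔖) where
  open RelSig 𝔖
  open FunSyms Φ
  open Str

  𝔖' : RelSig
  𝔖' = AlgSig 𝔖 Φ

  cons : (X : Str 𝔖') (f : Fun) → El X (cod f) → ((i : Fin (ar f)) → El X (dom f i)) →
         (i : Fin (suc (ar f))) → El X (RelSig.srt 𝔖' (inj₂ f) i)
  cons X f y xs zero = y
  cons X f y xs (suc i) = xs i

  IsAlg : Str 𝔖' → Set
  IsAlg X = (f : Fun) (xs : (i : Fin (ar f)) → El X (dom f i)) (y y' : El X (cod f)) →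
            rel X (inj₂ f) (cons X f y xs) → rel X (inj₂ f) (cons X f y' xs) →
            Eq X (cod f) y y'

  data Term : Sort → Set where
    var : (s : Sort) → ℕ → Term s
    app : (f : Fun) → ((i : Fin (ar f)) → Term (dom f i)) → Term (cod f)

  data Atom : Set where
    pred : (p : Sym) → ((i : Fin (len p)) → Term (srt p i)) → Atom
    def  : (s : Sort) → Term s → Atom
    eqv  : (s : Sort) → Term s → Term s → Atom

  Formula : Set
  Formula = List Atom

  record Sequent : Set where
    constructor _⟹_
    field
      prem  : Formula
      concl : Formula
  open Sequent public

  Theory : Set₁
  Theory = Sequent → Set

  data OccT : {t : Sort} → Term t → Sort → ℕ → Set where
    here : ∀ s n → OccT (var s n) s n
    sub  : ∀ {s n} f ts i → OccT (ts i) s n → OccT (app f ts) s n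

  data OccA : Atom → Sort → ℕ → Set where
    pred-occ : ∀ {s n} p ts i → OccT (ts i) s n → OccA (pred p ts) s n
    def-occ  : ∀ {s n} t (u : Term t) → OccT u s n → OccA (def t u) s n
    eq-occˡ  : ∀ {s n} t (u v : Term t) → OccT u s n → OccA (eqv t u v) s n
    eq-occʳ  : ∀ {s n} t (u v : Term t) → OccT v s n → OccA (eqv t u v) s n

  Occ : Formula → Sort → ℕ → Set
  Occ F s n = Any (λ a → OccA a s n) F

  Epic : Sequent → Set
  Epic (F ⟹ G) = ∀ s n → Occ G s n → Occ F s n

  EpicTheory : Theory → Set
  EpicTheory T = (S : Sequent) → T S → Epic S

  module _ (X : Str 𝔖') where
    Eval : {O : Sort → ℕ → Set} (I : Assign X O) {s : Sort} → Term s → El X s → Set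
    Eval I (var s n) x = Value I s n x
    Eval I (app f ts) x = Σ[ xs ∈ ((i : Fin (ar f)) → El X (dom f i)) ]
                            ((∀ i → Eval I (ts i) (xs i)) × rel X (inj₂ f) (cons X f x xs))

    HoldsA : {F : Formula} → Assign X (Occ F) → Atom → Set
    HoldsA I (pred p ts) = Σ[ xs ∈ ((i : Fin (len p)) → El X (srt p i)) ]
                             ((∀ i → Eval I (ts i) (xs i)) × rel X (inj₁ p) xs)
    HoldsA I (def s t) = Σ[ x ∈ El X s ] Eval I t x
    HoldsA I (eqv s t u) = Σ[ x ∈ El X s ] Σ[ y ∈ El X s ]
                             (Eval I t x × Eval I u y × Eq X s x y)

    Interp : Formula → Set
    Interp F = Σ[ I ∈ Assign X (Occ F) ] All (HoldsA I) F

    Sat : Sequent → Set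
    Sat (F ⟹ G) = (I : Interp F) →
      Σ[ J ∈ Interp (F ++ G) ] Extends (++⁺ˡ {ys = G}) (proj₁ J) (proj₁ I)

  Mod : Theory → Str 𝔖' → Set
  Mod T X = IsAlg X × ((S : Sequent) → T S → Sat X S)

  U₀ : Str 𝔖' → Str 𝔖
  U₀ X = record { car = car X ; rel = λ r → rel X (inj₁ r) ; rel-resp = λ r → rel-resp X (inj₁ r) }

  U₁ : {X Y : Str 𝔖'} → Hom X Y → Hom (U₀ X) (U₀ Y)
  U₁ h = record { fun = Hom.fun h ; cong = Hom.cong h ; pres = λ r → Hom.pres h (inj₁ r) }

  record RestrictsToEquivalence (A : Str 𝔖' → Set) (B : Str 𝔖 → Set) : Set₁ where
    field
      maps     : (X : Str 𝔖') → A X → B (U₀ X)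
      full     : (X Y : Str 𝔖') → A X → A Y → (g : Hom (U₀ X) (U₀ Y)) →
                 Σ[ h ∈ Hom X Y ] (U₁ h ≈ₕ g)
      faithful : (X Y : Str 𝔖') → A X → A Y → (h k : Hom X Y) → U₁ h ≈ₕ U₁ k → h ≈ₕ k
      esssurj  : (Z : Str 𝔖) → B Z → Σ[ X ∈ Str 𝔖' ] (A X × Iso (U₀ X) Z)

module Submission where

-- The function symbols are Skolem functions: for each sequent S : F ⟹ G of T
-- and each variable v of F ∧ G there is a symbol f_{S,v} taking the variable
-- occurrences of F as arguments. The axioms of T' say that on an interpretation
-- x̄ of F the values f_{S,v}(x̄) are defined and form the unique extension of x̄
-- to an interpretation of F ∧ G, and that f_{S,v} is defined only on
-- interpretations of F. Since interpretations of F are the same as morphisms out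
-- of [F], in a model of T' these values give the unique factorisation through
-- [S]; conversely, in a structure orthogonal to every [S] the factorisations
-- define the graphs of the f_{S,v}. These graphs are determined by the relational
-- reduct, so every morphism of reducts preserves them, which makes the forgetful
-- functor full and faithful. When T is strong, orthogonality amounts to
-- injectivity, i.e. to satisfying T.

open import Defs
open import Data.Nat using (ℕ; suc)
open import Data.Fin using (Fin; zero; suc; toℕ)
open import Data.Fin.Properties using (toℕ-injective)
open import Data.Product using (Σ; Σ-syntax; _×_; _,_; proj₁; proj₂)
open import Data.Sum using (_⊎_; inj₁; inj₂)
open import Data.List using (List; []; _∷_; [_]; _++_; length; lookup; tabulate; map)
open import Data.List.Relation.Unary.Any as Any using (here; there)
open import Data.List.Relation.Unary.Any.Properties using (++⁺ˡ; ++⁺ʳ; ++⁻; lookup-index; map⁺; map⁻)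
open import Data.List.Relation.Unary.All as All using (_∷_; [])
import Data.List.Relation.Unary.All.Properties as Allₚ
open import Data.List.Membership.Propositional using (_∈_)
open import Data.List.Membership.Propositional.Properties using (∈-tabulate⁺; ∈-tabulate⁻; ∈-lookup; ∈-map⁺)
open import Relation.Binary using (Setoid)
open import Relation.Binary.PropositionalEquality using (_≡_; refl; subst) renaming (sym to ≡-sym; cong to ≡-cong)
open import Relation.Binary.Construct.Closure.ReflexiveTransitive using (ε; _◅_)
open import Relation.Binary.Construct.Closure.Symmetric using (fwd; bwd)
import Relation.Binary.Construct.Closure.Equivalence as EqC

module Equality {𝔖 : RelSig} (X : Str 𝔖) where

  ≈-refl : ∀ {s} {x : El X s} → Eq X s x x
  ≈-refl {s} = Setoid.refl (Str.car X s)

  ≈-sym : ∀ {s} {x y : El X s} → Eq X s x y → Eq X s y x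
  ≈-sym {s} = Setoid.sym (Str.car X s)

  infixr 5 _⟨≈⟩_
  _⟨≈⟩_ : ∀ {s} {x y z : El X s} → Eq X s x y → Eq X s y z → Eq X s x z
  _⟨≈⟩_ {s} = Setoid.trans (Str.car X s)

module RHLProperties (𝔖 : RelSig) where
  open RelSig 𝔖
  open RHL 𝔖
  open Str
  open Hom

  occ-rel : ∀ {F r vs} → relA r vs ∈ F → (i : Fin (len r)) → Occ F (srt r i) (vs i)
  occ-rel m i = Any.map (λ { refl → rel-occ _ _ i }) m

  occ-def : ∀ {F s n} → def s n ∈ F → Occ F s n
  occ-def = Any.map (λ { refl → def-occ _ _ })

  occ-eqvˡ : ∀ {F s n m} → eqv s n m ∈ F → Occ F s n
  occ-eqvˡ = Any.map (λ { refl → eq-occˡ _ _ _ })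

  occ-eqvʳ : ∀ {F s n m} → eqv s n m ∈ F → Occ F s m
  occ-eqvʳ = Any.map (λ { refl → eq-occʳ _ _ _ })

  module _ (X : Str 𝔖) where
    open Equality X

    interp-resp-Step : ∀ {F s n m} (I : Interp X F) → Step F s n m →
                       (p : Occ F s n) (q : Occ F s m) → Eq X s (val (proj₁ I) p) (val (proj₁ I) q)
    interp-resp-Step (I , holds) e p q with All.lookup holds e
    ... | _ , _ , (p' , x≈) , (q' , y≈) , x≈y =
      irr I p p' ⟨≈⟩ x≈ ⟨≈⟩ x≈y ⟨≈⟩ ≈-sym y≈ ⟨≈⟩ irr I q' q

    interp-resp-Cls : ∀ {F s n m} (I : Interp X F) → Cls F s n m →
                      (p : Occ F s n) (q : Occ F s m) → Eq X s (val (proj₁ I) p) (val (proj₁ I) q)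
    interp-resp-Cls I ε p q = irr (proj₁ I) p q
    interp-resp-Cls I (fwd e ◅ c) p q = interp-resp-Step I e p (occ-eqvʳ e) ⟨≈⟩ interp-resp-Cls I c _ q
    interp-resp-Cls I (bwd e ◅ c) p q =
      ≈-sym (interp-resp-Step I e (occ-eqvˡ e) p) ⟨≈⟩ interp-resp-Cls I c _ q

    interp→hom : ∀ {F} → Interp X F → Hom ⟦ F ⟧ X
    interp→hom {F} I = record
      { fun  = λ s x → val (proj₁ I) (proj₂ x)
      ; cong = λ s {x} {y} c → interp-resp-Cls I c (proj₂ x) (proj₂ y)
      ; pres = preserves }
      where
      preserves : (r : Sym) (xs : (i : Fin (len r)) → El ⟦ F ⟧ (srt r i)) →
                  rel ⟦ F ⟧ r xs → rel X r (λ i → val (proj₁ I) (proj₂ (xs i)))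
      preserves r xs (vs , m , c) with All.lookup (proj₂ I) m
      ... | ys , values , r-ys = rel-resp X r (λ i → ≈-sym (proj₂ (values i)) ⟨≈⟩
              interp-resp-Cls I (EqC.symmetric (Step F (srt r i)) (c i)) (proj₁ (values i)) (proj₂ (xs i))) r-ys

    hom→interp : ∀ {F} → Hom ⟦ F ⟧ X → Interp X F
    hom→interp {F} a = I , All.tabulate holds
      where
      I : Assign X (Occ F)
      I = record { val = λ {s} {n} p → fun a s (n , p) ; irr = λ {s} p q → cong a s ε }
      holds : ∀ {α} → α ∈ F → HoldsA X I α
      holds {relA r vs} m = (λ i → fun a _ (vs i , occ-rel m i)) , (λ i → occ-rel m i , ≈-refl) ,
                            pres a r (λ i → vs i , occ-rel m i) (vs , m , λ i → ε)
      holds {def s n} m = fun a s (n , occ-def m) , occ-def m , ≈-refl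
      holds {eqv s n k} m = fun a s (n , occ-eqvˡ m) , fun a s (k , occ-eqvʳ m) ,
                            (occ-eqvˡ m , ≈-refl) , (occ-eqvʳ m , ≈-refl) , cong a s (fwd m ◅ ε)

    Sat⇒Injective : (S : Sequent) → Sat X S → Injective X ⟦ S ⟧ₛ
    Sat⇒Injective (F ⟹ G) sat a with sat (hom→interp a)
    ... | J , extends = interp→hom J , λ s x → extends (proj₂ x)

    Injective⇒Sat : (S : Sequent) → Injective X ⟦ S ⟧ₛ → Sat X S
    Injective⇒Sat (F ⟹ G) inj I with inj (interp→hom I)
    ... | b , factors = hom→interp b , λ {s} {n} p → factors s (n , p)

  Mod⇒Inj : ∀ {T} (X : Str 𝔖) → Mod T X → Inj T X
  Mod⇒Inj X mod S t = Sat⇒Injective X S (mod S t)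

  Inj⇒Mod : ∀ {T} (X : Str 𝔖) → Inj T X → Mod T X
  Inj⇒Mod X inj S t = Injective⇒Sat X S (inj S t)

  Orth⇒Mod : ∀ {T} → Strong T → (X : Str 𝔖) → Orth T X → Mod T X
  Orth⇒Mod strong X orth = Inj⇒Mod X (proj₂ (strong X) orth)

  Mod⇒Orth : ∀ {T} → Strong T → (X : Str 𝔖) → Mod T X → Orth T X
  Mod⇒Orth strong X mod = proj₁ (strong X) (Mod⇒Inj X mod)

  atomVars : Atom → List (Sort × ℕ)
  atomVars (relA r vs) = tabulate (λ i → srt r i , vs i)
  atomVars (def s n) = [ s , n ]
  atomVars (eqv s n m) = (s , n) ∷ (s , m) ∷ []

  vars : Formula → List (Sort × ℕ)
  vars [] = []
  vars (α ∷ F) = atomVars α ++ vars F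

  ∈-atomVars⁺ : ∀ {α s n} → OccA α s n → (s , n) ∈ atomVars α
  ∈-atomVars⁺ (rel-occ r vs i) = ∈-tabulate⁺ i
  ∈-atomVars⁺ (def-occ s n) = here refl
  ∈-atomVars⁺ (eq-occˡ s n m) = here refl
  ∈-atomVars⁺ (eq-occʳ s n m) = there (here refl)

  ∈-atomVars⁻ : ∀ α {s n} → (s , n) ∈ atomVars α → OccA α s n
  ∈-atomVars⁻ (relA r vs) m with ∈-tabulate⁻ m
  ... | i , refl = rel-occ r vs i
  ∈-atomVars⁻ (def s n) (here refl) = def-occ s n
  ∈-atomVars⁻ (eqv s n m) (here refl) = eq-occˡ s n m
  ∈-atomVars⁻ (eqv s n m) (there (here refl)) = eq-occʳ s n m

  ∈-vars⁺ : ∀ {F s n} → Occ F s n → (s , n) ∈ vars F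
  ∈-vars⁺ {α ∷ F} (here o) = ++⁺ˡ (∈-atomVars⁺ o)
  ∈-vars⁺ {α ∷ F} (there o) = ++⁺ʳ (atomVars α) (∈-vars⁺ o)

  ∈-vars⁻ : ∀ F {s n} → (s , n) ∈ vars F → Occ F s n
  ∈-vars⁻ (α ∷ F) m with ++⁻ (atomVars α) m
  ... | inj₁ m' = here (∈-atomVars⁻ α m')
  ... | inj₂ m' = there (∈-vars⁻ F m')

  Position : Formula → Set
  Position F = Fin (length (vars F))

  sortAt : (F : Formula) → Position F → Sort
  sortAt F k = proj₁ (lookup (vars F) k)

  nameAt : (F : Formula) → Position F → ℕ
  nameAt F k = proj₂ (lookup (vars F) k)

  occAt : ∀ F (k : Position F) → Occ F (sortAt F k) (nameAt F k)
  occAt F k = ∈-vars⁻ F (∈-lookup k)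

  position : ∀ {F s n} → Occ F s n → Position F
  position o = Any.index (∈-vars⁺ o)

  lookup-position : ∀ {F s n} (o : Occ F s n) → lookup (vars F) (position o) ≡ (s , n)
  lookup-position o = ≡-sym (lookup-index (∈-vars⁺ o))

  position-elim : ∀ {F} (Q : ∀ {s n} → Occ F s n → Position F → Set) →
                  (∀ {s n k} {o o' : Occ F s n} → Q o k → Q o' k) →
                  (∀ k → Q (occAt F k) k) →
                  ∀ {s n} k → lookup (vars F) k ≡ (s , n) → (o : Occ F s n) → Q o k
  position-elim {F} Q resp at k e o = resp (proj₂ (subst P e (occAt F k , at k)))
    where
    P : Sort × ℕ → Set
    P (s , n) = Σ[ o' ∈ Occ F s n ] Q o' k

  ≈ₕ-by-positions : ∀ {F} {Z : Str 𝔖} (a a' : Hom ⟦ F ⟧ Z) →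
                    (∀ k → Eq Z (sortAt F k) (fun a _ (_ , occAt F k)) (fun a' _ (_ , occAt F k))) → a ≈ₕ a'
  ≈ₕ-by-positions {F} {Z} a a' agree s (n , o) =
    position-elim (λ o _ → Eq Z _ (fun a _ (_ , o)) (fun a' _ (_ , o)))
                  (λ e → cong a _ ε ⟨≈⟩ e ⟨≈⟩ cong a' _ ε) agree (position o) (lookup-position o) o
    where open Equality Z

module PHLProperties (𝔖 : RelSig) (Φ : FunSyms 𝔖) where
  open RelSig 𝔖
  open FunSyms Φ
  open PHL 𝔖 Φ
  private module R = RHL 𝔖
  open RHLProperties 𝔖
  open Str
  open Hom

  RestrictsToEquivalence-resp : ∀ {A B B'} → (∀ Z → B Z → B' Z) → (∀ Z → B' Z → B Z) →
                                RestrictsToEquivalence A B → RestrictsToEquivalence A B'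
  RestrictsToEquivalence-resp to from eq = record
    { maps     = λ X a → to _ (maps X a)
    ; full     = full
    ; faithful = faithful
    ; esssurj  = λ Z b → esssurj Z (from Z b) }
    where open RestrictsToEquivalence eq

  ⌜_⌝ₐ : R.Atom → Atom
  ⌜ R.relA r vs ⌝ₐ = pred r (λ i → var (srt r i) (vs i))
  ⌜ R.def s n ⌝ₐ = def s (var s n)
  ⌜ R.eqv s n m ⌝ₐ = eqv s (var s n) (var s m)

  ⌜_⌝ : R.Formula → Formula
  ⌜_⌝ = map ⌜_⌝ₐ

  occA-⌜⌝⁺ : ∀ {α s n} → R.OccA α s n → OccA ⌜ α ⌝ₐ s n
  occA-⌜⌝⁺ (R.rel-occ r vs i) = pred-occ r _ i (here _ _)
  occA-⌜⌝⁺ (R.def-occ s n) = def-occ s _ (here _ _)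
  occA-⌜⌝⁺ (R.eq-occˡ s n m) = eq-occˡ s _ _ (here _ _)
  occA-⌜⌝⁺ (R.eq-occʳ s n m) = eq-occʳ s _ _ (here _ _)

  occA-⌜⌝⁻ : ∀ α {s n} → OccA ⌜ α ⌝ₐ s n → R.OccA α s n
  occA-⌜⌝⁻ (R.relA r vs) (pred-occ _ _ i (here _ _)) = R.rel-occ r vs i
  occA-⌜⌝⁻ (R.def s n) (def-occ _ _ (here _ _)) = R.def-occ s n
  occA-⌜⌝⁻ (R.eqv s n m) (eq-occˡ _ _ _ (here _ _)) = R.eq-occˡ s n m
  occA-⌜⌝⁻ (R.eqv s n m) (eq-occʳ _ _ _ (here _ _)) = R.eq-occʳ s n m

  occ-⌜⌝⁺ : ∀ {F s n} → R.Occ F s n → Occ ⌜ F ⌝ s n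
  occ-⌜⌝⁺ o = map⁺ (Any.map occA-⌜⌝⁺ o)

  occ-⌜⌝⁻ : ∀ {F s n} → Occ ⌜ F ⌝ s n → R.Occ F s n
  occ-⌜⌝⁻ o = Any.map (λ {α} → occA-⌜⌝⁻ α) (map⁻ o)

  var-occ-name : ∀ {s₁ n₁ s n} → OccT (var s₁ n₁) s n → n₁ ≡ n
  var-occ-name (here _ _) = refl

  var-occ-here : ∀ {s n} (o : OccT (var s n) s n) → o ≡ here s n
  var-occ-here (here _ _) = refl

  module _ (X : Str 𝔖') where
    open Equality X

    ValueMap : {O O' : Sort → ℕ → Set} → Assign X O → Assign X O' → Set
    ValueMap I J = ∀ {s n x} → Value I s n x → Value J s n x

    eval-map : ∀ {O O'} {I : Assign X O} {J : Assign X O'} → ValueMap I J →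
               ∀ {s} (t : Term s) {x} → Eval X I t x → Eval X J t x
    eval-map V (var s n) e = V e
    eval-map V (app f ts) (xs , es , r) = xs , (λ i → eval-map V (ts i) (es i)) , r

    holds-map : ∀ {F F'} {I : Assign X (Occ F)} {J : Assign X (Occ F')} → ValueMap I J →
                ∀ α → HoldsA X I α → HoldsA X J α
    holds-map V (pred p ts) (xs , es , r) = xs , (λ i → eval-map V (ts i) (es i)) , r
    holds-map V (def s t) (x , e) = x , eval-map V t e
    holds-map V (eqv s t u) (x , y , e₁ , e₂ , x≈y) = x , y , eval-map V t e₁ , eval-map V u e₂ , x≈y

    sat-single : ∀ {F β} → (∀ {s n} → Occ [ β ] s n → Occ F s n) →
                 ((I : Interp X F) → HoldsA X (proj₁ I) β) → Sat X (F ⟹ [ β ])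
    sat-single {F} {β} epic holds I =
      (J , Allₚ.++⁺ (All.map (λ {α} → holds-map V α) (proj₂ I)) (holds-map V β (holds I) ∷ [])) ,
      λ p → irr (proj₁ I) _ p
      where
      restrict : ∀ {s n} → Occ (F ++ [ β ]) s n → Occ F s n
      restrict q with ++⁻ F q
      ... | inj₁ p = p
      ... | inj₂ p = epic p
      J : Assign X (Occ (F ++ [ β ]))
      J = record { val = λ q → val (proj₁ I) (restrict q) ; irr = λ p q → irr (proj₁ I) _ _ }
      V : ValueMap (proj₁ I) J
      V (p , e) = ++⁺ˡ p , irr (proj₁ I) _ p ⟨≈⟩ e

    apply-single : ∀ {F β} → Sat X (F ⟹ [ β ]) → (I : Interp X F) →
                   Σ[ J ∈ Assign X (Occ (F ++ [ β ])) ]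
                     ((∀ {s n x} → Value J s n x → (p : Occ F s n) → Eq X s x (val (proj₁ I) p)) ×
                      HoldsA X J β)
    apply-single {F} sat I with sat I
    ... | (J , holds) , extends =
      J , (λ { (q , e) p → ≈-sym e ⟨≈⟩ irr J q (++⁺ˡ p) ⟨≈⟩ extends p }) ,
      All.head (Allₚ.++⁻ʳ F holds)

    interp-⌜⌝⁻ : ∀ {F} → Interp X ⌜ F ⌝ → R.Interp (U₀ X) F
    interp-⌜⌝⁻ {F} (I , holds) = I' , All.tabulate holds'
      where
      I' : Assign (U₀ X) (R.Occ F)
      I' = record { val = λ p → val I (occ-⌜⌝⁺ p) ; irr = λ p q → irr I _ _ }
      V : ∀ {s n x} → Value I s n x → Value I' s n x
      V (p , e) = occ-⌜⌝⁻ p , irr I _ p ⟨≈⟩ e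
      holds' : ∀ {α} → α ∈ F → R.HoldsA (U₀ X) I' α
      holds' {α} m with All.lookup holds (∈-map⁺ ⌜_⌝ₐ m)
      holds' {R.relA r vs} m | xs , es , r-xs = xs , (λ i → V (es i)) , r-xs
      holds' {R.def s n} m | x , e = x , V e
      holds' {R.eqv s n k} m | x , y , e₁ , e₂ , x≈y = x , y , V e₁ , V e₂ , x≈y

    interp-⌜⌝⁺ : ∀ {F} → R.Interp (U₀ X) F → Interp X ⌜ F ⌝
    interp-⌜⌝⁺ {F} (I , holds) = I' , Allₚ.map⁺ (All.map (λ {α} → holds' α) holds)
      where
      I' : Assign X (Occ ⌜ F ⌝)
      I' = record { val = λ p → val I (occ-⌜⌝⁻ p) ; irr = λ p q → irr I _ _ }
      V : ∀ {s n x} → Value I s n x → Value I' s n x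
      V (p , e) = occ-⌜⌝⁺ p , irr I _ p ⟨≈⟩ e
      holds' : ∀ α → R.HoldsA (U₀ X) I α → HoldsA X I' ⌜ α ⌝ₐ
      holds' (R.relA r vs) (xs , es , r-xs) = xs , (λ i → V (es i)) , r-xs
      holds' (R.def s n) (x , e) = x , V e
      holds' (R.eqv s n k) (x , y , e₁ , e₂ , x≈y) = x , y , V e₁ , V e₂ , x≈y

    ⌜⌝-interp→hom : ∀ {F} → Interp X ⌜ F ⌝ → Hom R.⟦ F ⟧ (U₀ X)
    ⌜⌝-interp→hom I = interp→hom (U₀ X) (interp-⌜⌝⁻ I)

    hom→⌜⌝-interp : ∀ {F} → Hom R.⟦ F ⟧ (U₀ X) → Interp X ⌜ F ⌝
    hom→⌜⌝-interp a = interp-⌜⌝⁺ (hom→interp (U₀ X) a)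

    Agrees : ∀ {O F} → Assign X O → Hom R.⟦ F ⟧ (U₀ X) → Set
    Agrees {F = F} J a = ∀ {s n x} → Value J s n x → (p : R.Occ F s n) → Eq X s x (fun a s (n , p))

    apply-at-hom : ∀ {F β} → Sat X (⌜ F ⌝ ⟹ [ β ]) → (a : Hom R.⟦ F ⟧ (U₀ X)) →
                   Σ[ J ∈ Assign X (Occ (⌜ F ⌝ ++ [ β ])) ] (Agrees J a × HoldsA X J β)
    apply-at-hom sat a with apply-single sat (hom→⌜⌝-interp a)
    ... | J , agree , holds = J , (λ v p → agree v (occ-⌜⌝⁺ p) ⟨≈⟩ cong a _ ε) , holds

    GraphAt : (f : Fun) → ((k : Fin (ar f)) → El X (dom f k)) → El X (cod f) → Set
    GraphAt f v y = Σ[ xs ∈ ((k : Fin (ar f)) → El X (dom f k)) ]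
                      ((∀ k → Eq X (dom f k) (xs k) (v k)) × rel X (inj₂ f) (cons X f y xs))

    graph-functional : IsAlg X → ∀ f {v v' y y'} → (∀ k → Eq X (dom f k) (v k) (v' k)) →
                       GraphAt f v y → GraphAt f v' y' → Eq X (cod f) y y'
    graph-functional alg f {y' = y'} v≈v' (xs , xs≈ , r) (xs' , xs'≈ , r') =
      alg f xs _ _ r (rel-resp X (inj₂ f) same-args r')
      where
      same-args : ∀ i → Eq X _ (cons X f y' xs' i) (cons X f y' xs i)
      same-args zero = ≈-refl
      same-args (suc k) = xs'≈ k ⟨≈⟩ ≈-sym (v≈v' k) ⟨≈⟩ ≈-sym (xs≈ k)

    eval-app→graph : ∀ {O} {J : Assign X O} f ts (v : (k : Fin (ar f)) → El X (dom f k)) →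
                     (∀ k {x} → Eval X J (ts k) x → Eq X (dom f k) x (v k)) →
                     ∀ {y} → Eval X J (app f ts) y → GraphAt f v y
    eval-app→graph f ts v args (xs , es , r) = xs , (λ k → args k (es k)) , r

module Construction (𝔖 : RelSig) (T : RHL.Theory 𝔖) where
  open RelSig 𝔖
  private module R = RHL 𝔖
  open R using (relA; def; eqv)
  open RHLProperties 𝔖
  open Str
  open Hom

  record FunSym : Set where
    constructor fsym
    field
      premise conclusion : R.Formula
      axiom  : T (premise R.⟹ conclusion)
      sort   : Sort
      name   : ℕ
      occurs : R.Occ (premise ++ conclusion) sort name
  open FunSym

  Φ : FunSyms 𝔖
  Φ = record
    { Fun = FunSym ; ar = λ f → length (vars (premise f)) ; dom = λ f → sortAt (premise f) ; cod = sort }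

  open FunSyms Φ using (ar)
  open PHL 𝔖 Φ
  open PHLProperties 𝔖 Φ

  args : (f : FunSym) (k : Position (premise f)) → Term (sortAt (premise f) k)
  args f k = var _ (nameAt (premise f) k)

  params : (f : FunSym) (k : Position (premise f)) → Term (sortAt (premise f) k)
  params f k = var _ (toℕ k)

  skolem : (f : FunSym) → Term (sort f)
  skolem f = app f (args f)

  skolemAtom : ∀ F G (t : T (F R.⟹ G)) α → α ∈ F ++ G → Atom
  skolemAtom F G t (relA r vs) m = pred r (λ i → skolem (fsym F G t _ _ (occ-rel m i)))
  skolemAtom F G t (def s n) m = def s (skolem (fsym F G t _ _ (occ-def m)))
  skolemAtom F G t (eqv s n k) m =
    eqv s (skolem (fsym F G t _ _ (occ-eqvˡ m))) (skolem (fsym F G t _ _ (occ-eqvʳ m)))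

  paramAtom : (f : FunSym) (α : R.Atom) → α ∈ premise f → Atom
  paramAtom f (relA r vs) m = pred r (λ i → var _ (toℕ (position (occ-rel m i))))
  paramAtom f (def s n) m = def s (var s (toℕ (position (occ-def m))))
  paramAtom f (eqv s n k) m = eqv s (var s (toℕ (position (occ-eqvˡ m)))) (var s (toℕ (position (occ-eqvʳ m))))

  definedAtParams : FunSym → Formula
  definedAtParams f = [ def (sort f) (app f (params f)) ]

  -- In domain and domain-diag the variable z_k (numbered toℕ k) stands for the
  -- k-th entry of vars F; entries may repeat a variable, whence domain-diag.
  data T' : Sequent → Set where
    total       : (f : FunSym) → T' (⌜ premise f ⌝ ⟹ [ def (sort f) (skolem f) ])
    irrelevant  : ∀ F G t s n (p q : R.Occ (F ++ G) s n) →
                  T' (⌜ F ⌝ ⟹ [ eqv s (skolem (fsym F G t s n p)) (skolem (fsym F G t s n q)) ])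
    sound       : ∀ F G t α (m : α ∈ F ++ G) → T' (⌜ F ⌝ ⟹ [ skolemAtom F G t α m ])
    extends     : ∀ F G t s n (p : R.Occ F s n) →
                  T' (⌜ F ⌝ ⟹ [ eqv s (var s n) (skolem (fsym F G t s n (++⁺ˡ p))) ])
    unique      : (f : FunSym) →
                  T' (⌜ premise f ++ conclusion f ⌝ ⟹ [ eqv (sort f) (var (sort f) (name f)) (skolem f) ])
    domain      : (f : FunSym) (α : R.Atom) (m : α ∈ premise f) → T' (definedAtParams f ⟹ [ paramAtom f α m ])
    domain-diag : (f : FunSym) (s : Sort) (n : ℕ) (k k' : Position (premise f)) →
                  lookup (vars (premise f)) k ≡ (s , n) → lookup (vars (premise f)) k' ≡ (s , n) →
                  T' (definedAtParams f ⟹ [ eqv s (var s (toℕ k)) (var s (toℕ k')) ])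

  skolem-occ : (f : FunSym) → ∀ {s n} → OccT (skolem f) s n → R.Occ (premise f) s n
  skolem-occ f (sub _ _ k (here _ _)) = occAt (premise f) k

  param-occ : (f : FunSym) (k : Position (premise f)) → ∀ {s} → sortAt (premise f) k ≡ s →
              Occ (definedAtParams f) s (toℕ k)
  param-occ f k refl = here (def-occ _ _ (sub f (params f) k (here _ _)))

  param-occ-position : (f : FunSym) → ∀ {s n} (o : R.Occ (premise f) s n) →
                       Occ (definedAtParams f) s (toℕ (position o))
  param-occ-position f o = param-occ f (position o) (≡-cong proj₁ (lookup-position o))

  epic : EpicTheory T'
  epic _ (total f) _ _ (here (def-occ _ _ o)) = occ-⌜⌝⁺ (skolem-occ f o)
  epic _ (irrelevant F G t _ _ p q) _ _ (here (eq-occˡ _ _ _ o)) = occ-⌜⌝⁺ (skolem-occ _ o)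
  epic _ (irrelevant F G t _ _ p q) _ _ (here (eq-occʳ _ _ _ o)) = occ-⌜⌝⁺ (skolem-occ _ o)
  epic _ (sound F G t (relA r vs) m) _ _ (here (pred-occ _ _ i o)) = occ-⌜⌝⁺ (skolem-occ _ o)
  epic _ (sound F G t (def s n) m) _ _ (here (def-occ _ _ o)) = occ-⌜⌝⁺ (skolem-occ _ o)
  epic _ (sound F G t (eqv s n k) m) _ _ (here (eq-occˡ _ _ _ o)) = occ-⌜⌝⁺ (skolem-occ _ o)
  epic _ (sound F G t (eqv s n k) m) _ _ (here (eq-occʳ _ _ _ o)) = occ-⌜⌝⁺ (skolem-occ _ o)
  epic _ (extends F G t _ _ p) _ _ (here (eq-occˡ _ _ _ (here _ _))) = occ-⌜⌝⁺ p
  epic _ (extends F G t _ _ p) _ _ (here (eq-occʳ _ _ _ o)) = occ-⌜⌝⁺ (skolem-occ _ o)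
  epic _ (unique f) _ _ (here (eq-occˡ _ _ _ (here _ _))) = occ-⌜⌝⁺ (occurs f)
  epic _ (unique f) _ _ (here (eq-occʳ _ _ _ o)) = occ-⌜⌝⁺ (++⁺ˡ (skolem-occ f o))
  epic _ (domain f (relA r vs) m) _ _ (here (pred-occ _ _ i (here _ _))) = param-occ-position f (occ-rel m i)
  epic _ (domain f (def s n) m) _ _ (here (def-occ _ _ (here _ _))) = param-occ-position f (occ-def m)
  epic _ (domain f (eqv s n k) m) _ _ (here (eq-occˡ _ _ _ (here _ _))) = param-occ-position f (occ-eqvˡ m)
  epic _ (domain f (eqv s n k) m) _ _ (here (eq-occʳ _ _ _ (here _ _))) = param-occ-position f (occ-eqvʳ m)
  epic _ (domain-diag f _ _ k k' e e') _ _ (here (eq-occˡ _ _ _ (here _ _))) = param-occ f k (≡-cong proj₁ e)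
  epic _ (domain-diag f _ _ k k' e e') _ _ (here (eq-occʳ _ _ _ (here _ _))) = param-occ f k' (≡-cong proj₁ e')

  module ModelProperties (X : Str 𝔖') (alg : IsAlg X) (sat : (S : Sequent) → T' S → Sat X S) where
    open Equality X

    module Extension {F G} (t : T (F R.⟹ G)) (a : Hom R.⟦ F ⟧ (U₀ X)) where
      argsOf : (k : Position F) → El X (sortAt F k)
      argsOf k = fun a _ (_ , occAt F k)

      ArgsAgree : ∀ {O} → Assign X O → Set
      ArgsAgree J = ∀ k {x} → Value J (sortAt F k) (nameAt F k) x → Eq X _ x (argsOf k)

      agrees⇒args-agree : ∀ {O} (J : Assign X O) → Agrees X J a → ArgsAgree J
      agrees⇒args-agree J agree k v = agree v (occAt F k)

      skolem-defined : ∀ {s n} (p : R.Occ (F ++ G) s n) → Σ[ y ∈ El X s ] GraphAt X (fsym F G t s n p) argsOf y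
      skolem-defined p with apply-at-hom X (sat _ (total (fsym F G t _ _ p))) a
      ... | J , agree , (y , e) =
        y , eval-app→graph X {J = J} _ (args (fsym F G t _ _ p)) argsOf (agrees⇒args-agree J agree) e

      skolemValue : ∀ {s n} → R.Occ (F ++ G) s n → El X s
      skolemValue p = proj₁ (skolem-defined p)

      graph→skolemValue : ∀ {s n} (p : R.Occ (F ++ G) s n) {y} →
                          GraphAt X (fsym F G t s n p) argsOf y → Eq X s y (skolemValue p)
      graph→skolemValue p graph = graph-functional X alg _ (λ k → ≈-refl) graph (proj₂ (skolem-defined p))

      eval→skolemValue : ∀ {O} (J : Assign X O) → ArgsAgree J → ∀ {s n} (p : R.Occ (F ++ G) s n) {y} →
                         Eval X J (skolem (fsym F G t s n p)) y → Eq X s y (skolemValue p)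
      eval→skolemValue J agree p e =
        graph→skolemValue p (eval-app→graph X {J = J} _ (args (fsym F G t _ _ p)) argsOf agree e)

      skolemValue-irr : ∀ {s n} (p q : R.Occ (F ++ G) s n) → Eq X s (skolemValue p) (skolemValue q)
      skolemValue-irr p q with apply-at-hom X (sat _ (irrelevant F G t _ _ p q)) a
      ... | J , agree , (_ , _ , e₁ , e₂ , x≈y) =
        ≈-sym (eval→skolemValue J (agrees⇒args-agree J agree) p e₁) ⟨≈⟩ x≈y ⟨≈⟩
        eval→skolemValue J (agrees⇒args-agree J agree) q e₂

      extension-assign : Assign (U₀ X) (R.Occ (F ++ G))
      extension-assign = record { val = skolemValue ; irr = skolemValue-irr }

      extension-holds : ∀ {α} → α ∈ F ++ G → R.HoldsA (U₀ X) extension-assign α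
      extension-holds {α} m with apply-at-hom X (sat _ (sound F G t α m)) a
      extension-holds {relA r vs} m | J , agree , (xs , es , r-xs) =
        xs , (λ i → occ-rel m i , ≈-sym (eval→skolemValue J (agrees⇒args-agree J agree) _ (es i))) , r-xs
      extension-holds {def s n} m | J , agree , (y , e) =
        y , occ-def m , ≈-sym (eval→skolemValue J (agrees⇒args-agree J agree) _ e)
      extension-holds {eqv s n k} m | J , agree , (x , y , e₁ , e₂ , x≈y) =
        x , y , (occ-eqvˡ m , ≈-sym (eval→skolemValue J (agrees⇒args-agree J agree) _ e₁)) ,
                (occ-eqvʳ m , ≈-sym (eval→skolemValue J (agrees⇒args-agree J agree) _ e₂)) , x≈y

      extension : Hom R.⟦ F ++ G ⟧ (U₀ X)
      extension = interp→hom (U₀ X) (extension-assign , All.tabulate extension-holds)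

      extension-factors : (extension ∘ₕ R.⟦ F R.⟹ G ⟧ₛ) ≈ₕ a
      extension-factors s (n , p) with apply-at-hom X (sat _ (extends F G t s n p)) a
      ... | J , agree , (_ , _ , e₁ , e₂ , x≈y) =
        ≈-sym (eval→skolemValue J (agrees⇒args-agree J agree) (++⁺ˡ p) e₂) ⟨≈⟩ ≈-sym x≈y ⟨≈⟩
        agree e₁ p

      extension-unique : (b : Hom R.⟦ F ++ G ⟧ (U₀ X)) → (b ∘ₕ R.⟦ F R.⟹ G ⟧ₛ) ≈ₕ a →
                         b ≈ₕ extension
      extension-unique b factors s (n , p) with apply-at-hom X (sat _ (unique (fsym F G t s n p))) b
      ... | J , agree , (_ , _ , e₁ , e₂ , x≈y) =
        ≈-sym (agree e₁ p) ⟨≈⟩ x≈y ⟨≈⟩ eval→skolemValue J args-agree p e₂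
        where
        args-agree : ArgsAgree J
        args-agree k v = agree v (++⁺ˡ (occAt F k)) ⟨≈⟩ factors _ (_ , occAt F k)

    orthogonal : R.Orth T (U₀ X)
    orthogonal (F R.⟹ G) t a = extension , extension-factors , extension-unique
      where open Extension t a

    module GraphArguments (f : FunSym) (ys : (i : Fin (suc (ar f))) → El X (RelSig.srt 𝔖' (inj₂ f) i))
                          (r-ys : rel X (inj₂ f) ys) where
      param-val : ∀ {s n} → Occ (definedAtParams f) s n → El X s
      param-val (here (def-occ _ _ (sub _ _ k (here _ _)))) = ys (suc k)

      param-val-irr : ∀ {s n} (p q : Occ (definedAtParams f) s n) → Eq X s (param-val p) (param-val q)
      param-val-irr (here (def-occ _ _ (sub _ _ k (here _ _)))) (here (def-occ _ _ (sub _ _ k' o)))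
        with toℕ-injective (var-occ-name o)
      ... | refl rewrite var-occ-here o = ≈-refl

      ys≈cons : ∀ i → Eq X _ (ys i) (cons X f (ys zero) (λ k → ys (suc k)) i)
      ys≈cons zero = ≈-refl
      ys≈cons (suc k) = ≈-refl

      params-interp : Interp X (definedAtParams f)
      params-interp = record { val = param-val ; irr = param-val-irr } ,
        (ys zero , (λ k → ys (suc k)) , (λ k → param-occ f k refl , ≈-refl) ,
         rel-resp X (inj₂ f) ys≈cons r-ys) ∷ []

      argVal : ∀ {s n} → R.Occ (premise f) s n → El X s
      argVal p = param-val (param-occ-position f p)

      param-val-consistent : ∀ {s n} (k k' : Position (premise f))
                             (e : lookup (vars (premise f)) k ≡ (s , n))
                             (e' : lookup (vars (premise f)) k' ≡ (s , n)) →
                             Eq X s (param-val (param-occ f k (≡-cong proj₁ e)))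
                                    (param-val (param-occ f k' (≡-cong proj₁ e')))
      param-val-consistent k k' e e' with apply-single X (sat _ (domain-diag f _ _ k k' e e')) params-interp
      ... | J , agree , (_ , _ , e₁ , e₂ , x≈y) =
        ≈-sym (agree e₁ (param-occ f k (≡-cong proj₁ e))) ⟨≈⟩ x≈y ⟨≈⟩
        agree e₂ (param-occ f k' (≡-cong proj₁ e'))

      argVal-irr : ∀ {s n} (p q : R.Occ (premise f) s n) → Eq X s (argVal p) (argVal q)
      argVal-irr p q = param-val-consistent _ _ (lookup-position p) (lookup-position q)

      argVal-resp-Step : ∀ {s n m} → R.Step (premise f) s n m →
                         (p : R.Occ (premise f) s n) (q : R.Occ (premise f) s m) → Eq X s (argVal p) (argVal q)
      argVal-resp-Step {s} {n} {m} e p q with apply-single X (sat _ (domain f (eqv s n m) e)) params-interp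
      ... | J , agree , (_ , _ , e₁ , e₂ , x≈y) =
        argVal-irr p (occ-eqvˡ e) ⟨≈⟩
        ≈-sym (agree e₁ (param-occ-position f (occ-eqvˡ e))) ⟨≈⟩ x≈y ⟨≈⟩
        agree e₂ (param-occ-position f (occ-eqvʳ e)) ⟨≈⟩ argVal-irr (occ-eqvʳ e) q

      argVal-resp-Cls : ∀ {s n m} → R.Cls (premise f) s n m →
                        (p : R.Occ (premise f) s n) (q : R.Occ (premise f) s m) → Eq X s (argVal p) (argVal q)
      argVal-resp-Cls ε p q = argVal-irr p q
      argVal-resp-Cls (fwd e ◅ c) p q = argVal-resp-Step e p (occ-eqvʳ e) ⟨≈⟩ argVal-resp-Cls c _ q
      argVal-resp-Cls (bwd e ◅ c) p q = ≈-sym (argVal-resp-Step e (occ-eqvˡ e) p) ⟨≈⟩ argVal-resp-Cls c _ q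

      argVal-pres : (r : Sym) (xs : (i : Fin (len r)) → El R.⟦ premise f ⟧ (srt r i)) →
                    rel R.⟦ premise f ⟧ r xs → rel X (inj₁ r) (λ i → argVal (proj₂ (xs i)))
      argVal-pres r xs (vs , m , c) with apply-single X (sat _ (domain f (relA r vs) m)) params-interp
      ... | J , agree , (ws , es , r-ws) = rel-resp X (inj₁ r) (λ i →
              agree (es i) (param-occ-position f (occ-rel m i)) ⟨≈⟩
              argVal-resp-Cls (EqC.symmetric (R.Step (premise f) (srt r i)) (c i)) (occ-rel m i) (proj₂ (xs i))) r-ws

      args-hom : Hom R.⟦ premise f ⟧ (U₀ X)
      args-hom = record
        { fun  = λ s x → argVal (proj₂ x)
        ; cong = λ s {x} {y} c → argVal-resp-Cls c (proj₂ x) (proj₂ y)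
        ; pres = argVal-pres }

      args-hom-at : ∀ k → Eq X _ (fun args-hom _ (_ , occAt (premise f) k)) (ys (suc k))
      args-hom-at k = param-val-consistent _ k (lookup-position (occAt (premise f) k)) refl

      tuple-graph : GraphAt X f (λ k → fun args-hom _ (_ , occAt (premise f) k)) (ys zero)
      tuple-graph = (λ k → ys (suc k)) , (λ k → ≈-sym (args-hom-at k)) , rel-resp X (inj₂ f) ys≈cons r-ys

  graph-preserved : (X Y : Str 𝔖') → Mod T' X → Mod T' Y → (g : Hom (U₀ X) (U₀ Y)) (f : FunSym) →
                    (ys : (i : Fin (suc (ar f))) → El X (RelSig.srt 𝔖' (inj₂ f) i)) →
                    rel X (inj₂ f) ys → rel Y (inj₂ f) (λ i → fun g _ (ys i))
  graph-preserved X Y (algX , satX) (algY , satY) g f@(fsym F G t s n p) ys r-ys =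
    rel-resp Y (inj₂ f) same-tuple (proj₂ (proj₂ (proj₂ (EY.skolem-defined p))))
    where
    open Equality Y
    open ModelProperties.GraphArguments X algX satX f ys r-ys
    module EX = ModelProperties.Extension X algX satX t args-hom
    module EY = ModelProperties.Extension Y algY satY t (g ∘ₕ args-hom)
    extensions-commute : (g ∘ₕ EX.extension) ≈ₕ EY.extension
    extensions-commute = EY.extension-unique (g ∘ₕ EX.extension) (λ s x → cong g s (EX.extension-factors s x))
    same-tuple : ∀ i → Eq Y _ (cons Y f (EY.skolemValue p) (proj₁ (proj₂ (EY.skolem-defined p))) i)
                             (fun g _ (ys i))
    same-tuple zero =
      ≈-sym (extensions-commute s (n , p)) ⟨≈⟩ cong g s (Equality.≈-sym X (EX.graph→skolemValue p tuple-graph))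
    same-tuple (suc k) = proj₁ (proj₂ (proj₂ (EY.skolem-defined p))) k ⟨≈⟩ cong g _ (args-hom-at k)

  full : (X Y : Str 𝔖') → Mod T' X → Mod T' Y → (g : Hom (U₀ X) (U₀ Y)) →
         Σ[ h ∈ Hom X Y ] (U₁ h ≈ₕ g)
  full X Y mX mY g = record { fun = fun g ; cong = cong g ; pres = preserves } , λ s x → Equality.≈-refl Y
    where
    preserves : (r : Sym ⊎ FunSym) (ys : (i : Fin (RelSig.len 𝔖' r)) → El X (RelSig.srt 𝔖' r i)) →
                rel X r ys → rel Y r (λ i → fun g _ (ys i))
    preserves (inj₁ r) = pres g r
    preserves (inj₂ f) = graph-preserved X Y mX mY g f

  module Skolemization (Z : Str 𝔖) (orth : R.Orth T Z) where
    open Equality Z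

    extend : ∀ {F G} (t : T (F R.⟹ G)) → Hom R.⟦ F ⟧ Z → Hom R.⟦ F ++ G ⟧ Z
    extend {F} {G} t a = proj₁ (orth (F R.⟹ G) t a)

    extend-factors : ∀ {F G} (t : T (F R.⟹ G)) (a : Hom R.⟦ F ⟧ Z) →
                     (extend t a ∘ₕ R.⟦ F R.⟹ G ⟧ₛ) ≈ₕ a
    extend-factors {F} {G} t a = proj₁ (proj₂ (orth (F R.⟹ G) t a))

    extend-unique : ∀ {F G} (t : T (F R.⟹ G)) (a : Hom R.⟦ F ⟧ Z) (b : Hom R.⟦ F ++ G ⟧ Z) →
                    (b ∘ₕ R.⟦ F R.⟹ G ⟧ₛ) ≈ₕ a → b ≈ₕ extend t a
    extend-unique {F} {G} t a = proj₂ (proj₂ (orth (F R.⟹ G) t a))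

    Tuple : Sym ⊎ FunSym → Set
    Tuple r = (i : Fin (RelSig.len 𝔖' r)) → El Z (RelSig.srt 𝔖' r i)

    SkolemGraph : (f : FunSym) → Tuple (inj₂ f) → Set
    SkolemGraph f ys = Σ[ a ∈ Hom R.⟦ premise f ⟧ Z ]
      ((∀ k → Eq Z _ (fun a _ (_ , occAt (premise f) k)) (ys (suc k))) ×
       Eq Z (sort f) (fun (extend (axiom f) a) (sort f) (name f , occurs f)) (ys zero))

    skolemRel : (r : Sym ⊎ FunSym) → Tuple r → Set
    skolemRel (inj₁ r) = rel Z r
    skolemRel (inj₂ f) = SkolemGraph f

    skolemRel-resp : (r : Sym ⊎ FunSym) {xs ys : Tuple r} → (∀ i → Eq Z _ (xs i) (ys i)) →
                     skolemRel r xs → skolemRel r ys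
    skolemRel-resp (inj₁ r) xs≈ys = rel-resp Z r xs≈ys
    skolemRel-resp (inj₂ f) xs≈ys (a , args≈ , value≈) =
      a , (λ k → args≈ k ⟨≈⟩ xs≈ys (suc k)) , value≈ ⟨≈⟩ xs≈ys zero

    skolemized : Str 𝔖'
    skolemized = record { car = car Z ; rel = skolemRel ; rel-resp = skolemRel-resp }

    skolemized-alg : IsAlg skolemized
    skolemized-alg f xs y y' (a , args≈ , y≈) (a' , args≈' , y'≈) =
      ≈-sym y≈ ⟨≈⟩ extensions-agree (sort f) (name f , occurs f) ⟨≈⟩ y'≈
      where
      args-agree : a ≈ₕ a'
      args-agree = ≈ₕ-by-positions a a' (λ k → args≈ k ⟨≈⟩ ≈-sym (args≈' k))
      extensions-agree : extend (axiom f) a ≈ₕ extend (axiom f) a'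
      extensions-agree = extend-unique (axiom f) a' (extend (axiom f) a)
                           (λ s x → extend-factors (axiom f) a s x ⟨≈⟩ args-agree s x)

    skolemized-iso : Iso (U₀ skolemized) Z
    skolemized-iso = record { fun = λ s x → x ; cong = λ s e → e ; pres = λ r xs q → q } ,
                     record { fun = λ s x → x ; cong = λ s e → e ; pres = λ r xs q → q } ,
                     (λ s x → ≈-refl) , (λ s x → ≈-refl)

    private
      X : Str 𝔖'
      X = skolemized

    skolem-eval : ∀ {F G} (t : T (F R.⟹ G)) (I : Interp X ⌜ F ⌝) {s n} (p : R.Occ (F ++ G) s n) →
                  Eval X (proj₁ I) (skolem (fsym F G t s n p)) (fun (extend t (⌜⌝-interp→hom X I)) s (n , p))
    skolem-eval {F} t I p =
      (λ k → val (proj₁ I) (occ-⌜⌝⁺ (occAt F k))) , (λ k → occ-⌜⌝⁺ (occAt F k) , ≈-refl) ,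
      (⌜⌝-interp→hom X I , (λ k → ≈-refl) , ≈-refl)

    skolemAtom-holds : ∀ F G t α (m : α ∈ F ++ G) (I : Interp X ⌜ F ⌝) →
                       HoldsA X (proj₁ I) (skolemAtom F G t α m)
    skolemAtom-holds F G t (relA r vs) m I =
      (λ i → fun b _ (vs i , occ-rel m i)) , (λ i → skolem-eval t I (occ-rel m i)) ,
      pres b r _ (vs , m , λ i → ε)
      where b = extend t (⌜⌝-interp→hom X I)
    skolemAtom-holds F G t (def s n) m I = _ , skolem-eval t I (occ-def m)
    skolemAtom-holds F G t (eqv s n k) m I =
      _ , _ , skolem-eval t I (occ-eqvˡ m) , skolem-eval t I (occ-eqvʳ m) ,
      cong (extend t (⌜⌝-interp→hom X I)) s (fwd m ◅ ε)

    params→args-hom : ∀ f → Interp X (definedAtParams f) → Hom R.⟦ premise f ⟧ Z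
    params→args-hom f (_ , (_ , _ , _ , a , _) ∷ []) = a

    param-value : ∀ f (I : Interp X (definedAtParams f)) {s n} k → lookup (vars (premise f)) k ≡ (s , n) →
                  (o : R.Occ (premise f) s n) → Value (proj₁ I) s (toℕ k) (fun (params→args-hom f I) s (n , o))
    param-value f (I , (_ , _ , es , a , args≈ , _) ∷ []) =
      position-elim (λ {s} {n} o k → Value I s (toℕ k) (fun a s (n , o)))
                    (λ (q , e) → q , e ⟨≈⟩ cong a _ ε)
                    (λ k → proj₁ (es k) , proj₂ (es k) ⟨≈⟩ ≈-sym (args≈ k))

    param-value-at : ∀ f (I : Interp X (definedAtParams f)) {s n} (o : R.Occ (premise f) s n) →
                     Value (proj₁ I) s (toℕ (position o)) (fun (params→args-hom f I) s (n , o))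
    param-value-at f I o = param-value f I (position o) (lookup-position o) o

    paramAtom-holds : ∀ f α (m : α ∈ premise f) (I : Interp X (definedAtParams f)) →
                      HoldsA X (proj₁ I) (paramAtom f α m)
    paramAtom-holds f (relA r vs) m I =
      (λ i → fun a _ (vs i , occ-rel m i)) , (λ i → param-value-at f I (occ-rel m i)) ,
      pres a r _ (vs , m , λ i → ε)
      where a = params→args-hom f I
    paramAtom-holds f (def s n) m I = _ , param-value-at f I (occ-def m)
    paramAtom-holds f (eqv s n k) m I =
      _ , _ , param-value-at f I (occ-eqvˡ m) , param-value-at f I (occ-eqvʳ m) ,
      cong (params→args-hom f I) s (fwd m ◅ ε)

    skolem-unique : ∀ {F G} (t : T (F R.⟹ G)) (I : Interp X ⌜ F ++ G ⌝) {s n} (p : R.Occ (F ++ G) s n) →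
                    HoldsA X (proj₁ I) (eqv s (var s n) (skolem (fsym F G t s n p)))
    skolem-unique {F} {G} t I {s} {n} p =
      _ , _ , (occ-⌜⌝⁺ p , ≈-refl) ,
      ((λ k → val (proj₁ I) (occ-⌜⌝⁺ (++⁺ˡ (occAt F k)))) ,
       (λ k → occ-⌜⌝⁺ (++⁺ˡ (occAt F k)) , ≈-refl) ,
       (restriction , (λ k → ≈-refl) , ≈-refl)) ,
      extend-unique t restriction (⌜⌝-interp→hom X I) (λ s x → ≈-refl) s (n , p)
      where
      restriction : Hom R.⟦ F ⟧ Z
      restriction = ⌜⌝-interp→hom X I ∘ₕ R.⟦ F R.⟹ G ⟧ₛ

    skolemized-model : (S : Sequent) → T' S → Sat X S
    skolemized-model _ c@(total (fsym F G t s n p)) = sat-single X (epic _ c _ _) λ I → _ , skolem-eval t I p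
    skolemized-model _ c@(irrelevant F G t s n p q) = sat-single X (epic _ c _ _) λ I →
      _ , _ , skolem-eval t I p , skolem-eval t I q , cong (extend t (⌜⌝-interp→hom X I)) s ε
    skolemized-model _ c@(sound F G t α m) = sat-single X (epic _ c _ _) (skolemAtom-holds F G t α m)
    skolemized-model _ c@(extends F G t s n p) = sat-single X (epic _ c _ _) λ I →
      _ , _ , (occ-⌜⌝⁺ p , ≈-refl) , skolem-eval t I (++⁺ˡ p) ,
      ≈-sym (extend-factors t (⌜⌝-interp→hom X I) s (n , p))
    skolemized-model _ c@(unique (fsym F G t s n p)) = sat-single X (epic _ c _ _) λ I → skolem-unique t I p
    skolemized-model _ c@(domain f α m) = sat-single X (epic _ c _ _) (paramAtom-holds f α m)
    skolemized-model _ c@(domain-diag f s n k k' e e') = sat-single X (epic _ c _ _) λ I →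
      _ , _ , param-value f I k e o , param-value f I k' e' o , ≈-refl
      where
      o : R.Occ (premise f) s n
      o = subst (λ w → R.Occ (premise f) (proj₁ w) (proj₂ w)) e (occAt (premise f) k)

  equivalence : RestrictsToEquivalence (Mod T') (R.Orth T)
  equivalence = record
    { maps     = λ X (alg , sat) → ModelProperties.orthogonal X alg sat
    ; full     = full
    ; faithful = λ _ _ _ _ _ _ same → same
    ; esssurj  = λ Z orth → let open Skolemization Z orth in
                   skolemized , (skolemized-alg , skolemized-model) , skolemized-iso }

proposition4p33 : (𝔖 : RelSig) (T : RHL.Theory 𝔖) →
    Σ[ Φ ∈ FunSyms 𝔖 ] Σ[ T' ∈ PHL.Theory 𝔖 Φ ]
      ( PHL.EpicTheory 𝔖 Φ T'
      × PHL.RestrictsToEquivalence 𝔖 Φ (PHL.Mod 𝔖 Φ T') (RHL.Orth 𝔖 T)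
      × (RHL.Strong 𝔖 T → PHL.RestrictsToEquivalence 𝔖 Φ (PHL.Mod 𝔖 Φ T') (RHL.Mod 𝔖 T)) )
proposition4p33 𝔖 T =
  Φ , T' , epic , equivalence ,
  λ strong → RestrictsToEquivalence-resp (Orth⇒Mod strong) (Mod⇒Orth strong) equivalence
  where
  open Construction 𝔖 T
  open PHLProperties 𝔖 Φ
  open RHLProperties 𝔖
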